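{- Let $R$ and $H$ be (finite) hypergraphs, and let $\{V_\alpha\}_{\alpha\in A}$ be a partition of the vertex set of $H$ into disjoint sets such that any two vertices in the same $V_\alpha$ are min-equal in $H$ and $R$-equal. For every $\alpha\in A$ choose a representative $v_\alpha\in V_\alpha$ and give it weight $w(v_\alpha)=|V_\alpha|$ (all other vertices get weight $1$). Let $H_{cov}(\{v_\alpha\}_{\alpha\in A})$ be the sub-hypergraph of $H$ whose edges are the minimal edges of $H$ that are contained in $\{v_\alpha:\alpha\in A\}$. Then $$cov_R(H) = \min_{R'} \sum_{r\in R'} \prod_{v\in r} w(v),$$ where the minimum is taken over all $R$-covers $R'$ of $H_{cov}(\{v_\alpha\}_{\alpha\in A})$.
   Context: A hypergraph is a pair $(V,E)$ with $E$ a set of subsets of the finite set $V$. A minimal edge of $H$ is an edge that does not contain any other edge of $H$. Two distinct vertices $a,b$ of $H$ are min-equal if for every minimal edge $e$ of $H$: if $a\in e$ then $(e\setminus\{a\})\cup\{b\}$ is a minimal edge of $H$, and if $b\in e$ then $(e\setminus\{b\})\cup\{a\}$ is a minimal edge of $H$; every vertex is min-equal to itself. Vertices $a,b$ are $R$-equal if for every edge $e$ of $R$: if $a\in e$ and $b\notin e$ then $(e\setminus\{a\})\cup\{b\}$ is an edge of $R$, and if $b\in e$ and $a\notin e$ then $(e\setminus\{b\})\cup\{a\}$ is an edge of $R$. An $R$-cover of $H$ is a sub-hypergraph $C$ of $R$ such that every edge of $H$ contains at least one edge of $C$; $cov_R(H)$ is the minimum number of edges of an $R$-cover of $H$ ($\infty$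 if none exists). -}

module Defs where

open import Data.Nat using (ℕ; _≤_)
open import Data.Bool using (if_then_else_)
open import Data.Fin using (Fin; _≟_)
open import Data.Fin.Subset as S using (Subset; _∪_; _-_; ⁅_⁆; ∣_∣; _∉_)
open import Data.Fin.Subset.Properties using (_∈?_)
open import Data.List using (List; length; map; filter; allFin)
open import Data.Nat.ListAction using (sum; product)
open import Data.List.Membership.Propositional using (_∈_)
open import Data.List.Relation.Unary.Unique.Propositional using (Unique)
open import Data.List.Relation.Unary.All using (All)
open import Data.Product using (Σ; ∃; _×_)
open import Data.Sum using (_⊎_)
open import Data.Vec using (tabulate)
open import Relation.Nullary using (does)
open import Relation.Binary.PropositionalEquality using (_≡_)

-- A (finite) hypergraph on the vertex set Fin n: its (finite) set of edges,
-- each edge a subset of Fin n.  Membership of an edge is list membership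
-- (duplicates in the list are irrelevant).
Hypergraph : ℕ → Set
Hypergraph n = List (Subset n)

IsEdge : ∀ {n} → Hypergraph n → Subset n → Set
IsEdge H e = e ∈ H

MinimalEdge : ∀ {n} → Hypergraph n → Subset n → Set
MinimalEdge H e = IsEdge H e × (∀ f → IsEdge H f → f S.⊆ e → f ≡ e)

swap : ∀ {n} → Subset n → Fin n → Fin n → Subset n
swap e a b = (e - a) ∪ ⁅ b ⁆

MinEqual : ∀ {n} → Hypergraph n → Fin n → Fin n → Set
MinEqual H a b =
  a ≡ b ⊎
  (∀ e → MinimalEdge H e →
     (a S.∈ e → MinimalEdge H (swap e a b)) × (b S.∈ e → MinimalEdge H (swap e b a)))

REqual : ∀ {n} → Hypergraph n → Fin n → Fin n → Set
REqual R a b =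
  ∀ e → IsEdge R e →
    (a S.∈ e → b ∉ e → IsEdge R (swap e a b)) × (b S.∈ e → a ∉ e → IsEdge R (swap e b a))

-- A sub-hypergraph C of R (list of distinct edges of R) covers the edges
-- satisfying P when every such edge contains at least one edge of C.
-- The number of edges of C is  length C.
SubHypergraph : ∀ {n} → Hypergraph n → List (Subset n) → Set
SubHypergraph R C = Unique C × All (IsEdge R) C

CoversPred : ∀ {n} → (Subset n → Set) → List (Subset n) → Set
CoversPred P C = ∀ e → P e → Σ (Subset n) λ f → f ∈ C × f S.⊆ e
  where n = _

IsRCoverOf : ∀ {n} → Hypergraph n → (Subset n → Set) → List (Subset n) → Set
IsRCoverOf R P C = SubHypergraph R C × CoversPred P C

IsMinimum : (ℕ → Set) → ℕ → Set
IsMinimum P k = P k × (∀ j → P j → k ≤ j)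

-- cov_R(H) = k  (cov_R(H) = ∞ is the case where no k satisfies this)
CovIs : ∀ {n} → Hypergraph n → Hypergraph n → ℕ → Set
CovIs R H k = IsMinimum (λ j → ∃ λ C → IsRCoverOf R (IsEdge H) C × length C ≡ j) k

-- Partition of Fin n into classes labelled by Fin m (class of v is cls v).
-- The class V_α as a subset, and its size.
block : ∀ {n m} → (Fin n → Fin m) → Fin m → Subset n
block cls α = tabulate (λ v → does (cls v ≟ α))

-- weight: |V_α| on the representative v_α = rep α, 1 on every other vertex
-- (v is a representative iff v ≡ rep (cls v), given cls (rep α) ≡ α)
weight : ∀ {n m} → (Fin n → Fin m) → (Fin m → Fin n) → Fin n → ℕ
weight cls rep v = if does (v ≟ rep (cls v)) then ∣ block cls (cls v) ∣ else 1

edgeWeight : ∀ {n} → (Fin n → ℕ) → Subset n → ℕ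
edgeWeight {n} w r = product (map w (filter (_∈? r) (allFin n)))

coverWeight : ∀ {n} → (Fin n → ℕ) → List (Subset n) → ℕ
coverWeight w C = sum (map (edgeWeight w) C)

HcovEdge : ∀ {n m} → Hypergraph n → (Fin m → Fin n) → Subset n → Set
HcovEdge H rep e = MinimalEdge H e × (∀ v → v S.∈ e → ∃ λ α → rep α ≡ v)

WeightedMinIs : ∀ {n m} → Hypergraph n → Hypergraph n →
                (Fin n → Fin m) → (Fin m → Fin n) → ℕ → Set
WeightedMinIs R H cls rep k =
  IsMinimum (λ j → ∃ λ C → IsRCoverOf R (HcovEdge H rep) C × coverWeight (weight cls rep) C ≡ j) k

{-# OPTIONS --safe #-}
-- Let ρ map every vertex to the representative of its class. Since vertices of one class are
-- min-equal and R-equal, moving the vertices of a set that meets every class at most once to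
-- class-mates, one swap at a time, keeps minimal edges of H minimal and edges of R in R; and
-- minimal edges of H do meet every class at most once.
--
-- cov_R(H) ≤ min: replace every edge r ⊆ {v_α} of a weighted cover of H_cov by its ∏_{v∈r} w(v)
-- relabellings inside the classes. An edge e of H contains a minimal edge f, the projection ρ(f)
-- is an edge of H_cov and so contains an edge r of the weighted cover, and one relabelling of r
-- lies in f.
--
-- min ≤ cov_R(H): given an R-cover C of H, each choice σ of one vertex σ(v_α) in every class
-- yields the weighted cover {ρ(c) : c ∈ C, c ⊆ {σ(v_α)}} of H_cov (pull an edge of H_cov back
-- along σ). An edge c lies in {σ(v_α)} for at most a 1/∏_{v∈ρ(c)} w(v) fraction of the choices,
-- so these weighted covers have average weight at most |C|, and one of them attains it.

module Submission where

open import Defs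
open import Algebra.Properties.CommutativeSemigroup using (interchange)
open import Data.Bool using (true; false; if_then_else_)
import Data.Bool.Properties as Bool
open import Data.Fin using (Fin; zero; suc; _≟_)
open import Data.Fin.Properties using (any?; all?)
open import Data.Fin.Subset using (Subset; _⊆_; _⊂_; _─_; ⁅_⁆; ∣_∣; inside; outside)
  renaming (_∈_ to _∈ₛ_; _∉_ to _∉ₛ_)
open import Data.Fin.Subset.Induction using (⊂-wellFounded)
open import Data.Fin.Subset.Properties
  using (_∈?_; _⊆?_; _⊂?_; ⊆-antisym; ⊆-trans; x∈p∪q⁻; x∈p∪q⁺; x∈⁅x⁆; x∈⁅y⁆⇒x≡y; x∉⁅y⁆⇒x≢y; x∈p∧x≢y⇒x∈p-y;
         p─q⊆p)
open import Data.List
  using (List; []; _∷_; _++_; [_]; map; filter; length; tabulate; allFin; concatMap; deduplicate;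
         cartesianProductWith)
open import Data.List.Membership.Propositional using (_∈_; find; lose)
open import Data.List.Membership.Propositional.Properties
  using (∈-cartesianProductWith⁺; ∈-cartesianProductWith⁻; ∈-deduplicate⁺; ∈-deduplicate⁻; ∈-allFin;
         ∈-filter⁺; ∈-filter⁻; ∈-map⁺; ∈-map⁻; ∈-concatMap⁺; ∈-concatMap⁻)
open import Data.List.Properties
  using (map-++; map-∘; map-cong; map-cong-local; length-++; length-map; length-deduplicate)
open import Data.List.Relation.Unary.All as All using (All)
open import Data.List.Relation.Unary.AllPairs using ([]; _∷_)
open import Data.List.Relation.Unary.Any as Any using (here; there)
open import Data.List.Relation.Unary.Unique.Propositional using (Unique)
open import Data.List.Relation.Unary.Unique.Propositional.Properties using (allFin⁺; filter⁺)
import Data.List.Relation.Unary.Unique.DecPropositional.Properties as UniqueDec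
open import Data.Nat using (ℕ; zero; suc; _+_; _*_; _≤_; _≤?_; z≤n)
open import Data.Nat.ListAction using (sum; product)
open import Data.Nat.ListAction.Properties using (sum-++)
open import Data.Nat.Properties
  using (≤-refl; ≤-reflexive; ≤-trans; ≤-antisym; <⇒≤; ≰⇒>; m≤n+m; +-identityʳ; +-mono-≤; +-monoˡ-≤; +-monoʳ-≤;
         +-cancelˡ-≤; *-comm; *-identityˡ; *-identityʳ; *-zeroʳ; *-distribˡ-+; *-distribʳ-+; *-mono-≤; *-monoˡ-≤;
         +-commutativeSemigroup; *-1-monoid; module ≤-Reasoning)
open import Algebra.Properties.Monoid.Sum *-1-monoid using () renaming (sum to ∏; sum-cong-≗ to ∏-cong)
open import Data.Product using (∃; _×_; _,_; proj₁; proj₂)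
open import Data.Sum using (_⊎_; inj₁; inj₂)
open import Data.Vec as Vec using (_∷_)
open import Data.Vec.Base using () renaming (here to hereᵥ; there to thereᵥ)
open import Data.Vec.Functional as Vector using (Vector; updateAt)
open import Data.Vec.Functional.Properties using (updateAt-updates; updateAt-minimal; updateAt-id-local)
open import Data.Vec.Properties using (≡-dec; lookup∘tabulate; []=⇒lookup; lookup⇒[]=)
open import Function using (_∘_; id)
open import Function.Bundles using (_⇔_; mk⇔)
open import Induction.WellFounded using (Acc; acc)
open import Relation.Binary.PropositionalEquality
  using (_≡_; _≢_; refl; sym; trans; cong; cong₂; subst; subst₂; module ≡-Reasoning)
open import Relation.Nullary using (Dec; yes; no; does; ¬_; contradiction)
open import Relation.Nullary.Decidable using (dec-true; _×-dec_; _→-dec_)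
open import Relation.Unary using (Decidable)

private variable
  A B C : Set
  k : ℕ

sum-map-++ : (f : A → ℕ) (xs ys : List A) → sum (map f (xs ++ ys)) ≡ sum (map f xs) + sum (map f ys)
sum-map-++ f xs ys = trans (cong sum (map-++ f xs ys)) (sum-++ (map f xs) (map f ys))

sum-map-*ˡ : (c : ℕ) (f : A → ℕ) (xs : List A) → sum (map (λ x → c * f x) xs) ≡ c * sum (map f xs)
sum-map-*ˡ c f []       = sym (*-zeroʳ c)
sum-map-*ˡ c f (x ∷ xs) = trans (cong (c * f x +_) (sum-map-*ˡ c f xs)) (sym (*-distribˡ-+ c (f x) _))

sum-map-+ : (f g : A → ℕ) (xs : List A) → sum (map (λ x → f x + g x) xs) ≡ sum (map f xs) + sum (map g xs)
sum-map-+ f g []       = refl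
sum-map-+ f g (x ∷ xs) =
  trans (cong (f x + g x +_) (sum-map-+ f g xs)) (interchange +-commutativeSemigroup (f x) (g x) _ _)

sum-map-const : (c : ℕ) (xs : List A) → sum (map (λ _ → c) xs) ≡ length xs * c
sum-map-const c []       = refl
sum-map-const c (x ∷ xs) = cong (c +_) (sum-map-const c xs)

sum-map-mono-≤ : (f g : A → ℕ) (xs : List A) → (∀ {x} → x ∈ xs → f x ≤ g x) → sum (map f xs) ≤ sum (map g xs)
sum-map-mono-≤ f g []       f≤g = z≤n
sum-map-mono-≤ f g (x ∷ xs) f≤g = +-mono-≤ (f≤g (here refl)) (sum-map-mono-≤ f g xs (f≤g ∘ there))

sum-map-comm : (t : A → B → ℕ) (xs : List A) (ys : List B) →
  sum (map (λ x → sum (map (t x) ys)) xs) ≡ sum (map (λ y → sum (map (λ x → t x y) xs)) ys)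
sum-map-comm t []       ys = sym (trans (sum-map-const 0 ys) (*-zeroʳ (length ys)))
sum-map-comm t (x ∷ xs) ys = trans (cong (sum (map (t x) ys) +_) (sum-map-comm t xs ys))
  (sym (sum-map-+ (t x) (λ y → sum (map (λ x → t x y) xs)) ys))

sum-map-filter : {P : A → Set} (P? : Decidable P) (f : A → ℕ) (xs : List A) →
  sum (map f (filter P? xs)) ≡ sum (map (λ x → if does (P? x) then f x else 0) xs)
sum-map-filter P? f []       = refl
sum-map-filter P? f (x ∷ xs) with does (P? x)
... | true  = cong (f x +_) (sum-map-filter P? f xs)
... | false = sum-map-filter P? f xs

sum-map-filter-≤ : {P : A → Set} (P? : Decidable P) (f : A → ℕ) (xs : List A) →
  sum (map f (filter P? xs)) ≤ sum (map f xs)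
sum-map-filter-≤ P? f []       = z≤n
sum-map-filter-≤ P? f (x ∷ xs) with does (P? x)
... | true  = +-monoʳ-≤ (f x) (sum-map-filter-≤ P? f xs)
... | false = ≤-trans (sum-map-filter-≤ P? f xs) (m≤n+m _ (f x))

sum-map-deduplicate-≤ : {_≈_ : A → A → Set} (_≈?_ : ∀ x y → Dec (x ≈ y)) (f : A → ℕ) (xs : List A) →
  sum (map f (deduplicate _≈?_ xs)) ≤ sum (map f xs)
sum-map-deduplicate-≤ _≈?_ f []       = z≤n
sum-map-deduplicate-≤ _≈?_ f (x ∷ xs) = +-monoʳ-≤ (f x)
  (≤-trans (sum-map-filter-≤ _ f (deduplicate _≈?_ xs)) (sum-map-deduplicate-≤ _≈?_ f xs))

length-concatMap : (f : A → List B) (xs : List A) → length (concatMap f xs) ≡ sum (map (length ∘ f) xs)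
length-concatMap f []       = refl
length-concatMap f (x ∷ xs) = trans (length-++ (f x)) (cong (length (f x) +_) (length-concatMap f xs))

∃-below-average : (f : A → ℕ) (c : ℕ) {x : A} (xs : List A) → x ∈ xs →
  sum (map f xs) ≤ length xs * c → ∃ λ y → y ∈ xs × f y ≤ c
∃-below-average f c (y ∷ ys) _ Σ≤ with f y ≤? c
... | yes fy≤c = y , here refl , fy≤c
... | no fy≰c with ys
...   | []     = contradiction (subst₂ _≤_ (+-identityʳ (f y)) (+-identityʳ c) Σ≤) fy≰c
...   | z ∷ zs =
  let (u , u∈ , fu≤c) = ∃-below-average f c (z ∷ zs) (here refl)
                          (+-cancelˡ-≤ c _ _ (≤-trans (+-monoˡ-≤ _ (<⇒≤ (≰⇒> fy≰c))) Σ≤))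
  in u , there u∈ , fu≤c

∏-mono-≤ : (f g : Vector ℕ k) → (∀ i → f i ≤ g i) → ∏ f ≤ ∏ g
∏-mono-≤ {zero}  f g f≤g = ≤-refl
∏-mono-≤ {suc k} f g f≤g = *-mono-≤ (f≤g zero) (∏-mono-≤ (f ∘ suc) (g ∘ suc) (f≤g ∘ suc))

product-map-filter-tabulate : {P : A → Set} (P? : Decidable P) (w : A → ℕ) (f : Fin k → A) →
  product (map w (filter P? (tabulate f))) ≡ ∏ (λ i → if does (P? (f i)) then w (f i) else 1)
product-map-filter-tabulate {k = zero}  P? w f = refl
product-map-filter-tabulate {k = suc k} P? w f with does (P? (f zero))
... | true  = cong (w (f zero) *_) (product-map-filter-tabulate P? w (f ∘ suc))
... | false = trans (product-map-filter-tabulate P? w (f ∘ suc)) (sym (+-identityʳ _))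

length-filter-tabulate : {P : A → Set} (P? : Decidable P) (f : Fin k → A) →
  length (filter P? (tabulate f)) ≡ ∣ Vec.tabulate (λ i → does (P? (f i))) ∣
length-filter-tabulate {k = zero}  P? f = refl
length-filter-tabulate {k = suc k} P? f with does (P? (f zero))
... | true  = cong suc (length-filter-tabulate P? (f ∘ suc))
... | false = length-filter-tabulate P? (f ∘ suc)

unique⇒length≤1 : {xs : List A} → Unique xs → (∀ {x y} → x ∈ xs → y ∈ xs → x ≡ y) → length xs ≤ 1
unique⇒length≤1 {xs = []}         _                  _    = z≤n
unique⇒length≤1 {xs = x ∷ []}     _                  _    = ≤-refl
unique⇒length≤1 {xs = x ∷ y ∷ xs} ((x≢y All.∷ _) ∷ _) same =
  contradiction (same (here refl) (there (here refl))) x≢y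

sum-map-cartesianProductWith : (_·_ : A → B → C) (h : C → ℕ) (f : A → ℕ) (g : B → ℕ) →
  (∀ x y → h (x · y) ≡ f x * g y) → (xs : List A) (ys : List B) →
  sum (map h (cartesianProductWith _·_ xs ys)) ≡ sum (map f xs) * sum (map g ys)
sum-map-cartesianProductWith _·_ h f g h≡ []       ys = refl
sum-map-cartesianProductWith _·_ h f g h≡ (x ∷ xs) ys = begin
  sum (map h (map (x ·_) ys ++ cartesianProductWith _·_ xs ys))
    ≡⟨ sum-map-++ h (map (x ·_) ys) _ ⟩
  sum (map h (map (x ·_) ys)) + sum (map h (cartesianProductWith _·_ xs ys))
    ≡⟨ cong₂ _+_ (cong sum (trans (sym (map-∘ ys)) (map-cong (h≡ x) ys)))
                 (sum-map-cartesianProductWith _·_ h f g h≡ xs ys) ⟩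
  sum (map (λ y → f x * g y) ys) + sum (map f xs) * sum (map g ys)
    ≡⟨ cong (_+ _) (sum-map-*ˡ (f x) g ys) ⟩
  f x * sum (map g ys) + sum (map f xs) * sum (map g ys)
    ≡⟨ sym (*-distribʳ-+ _ (f x) _) ⟩
  (f x + sum (map f xs)) * sum (map g ys) ∎
  where open ≡-Reasoning

length-cartesianProductWith : (_·_ : A → B → C) (xs : List A) (ys : List B) →
  length (cartesianProductWith _·_ xs ys) ≡ length xs * length ys
length-cartesianProductWith _·_ []       ys = refl
length-cartesianProductWith _·_ (x ∷ xs) ys = trans (length-++ (map (x ·_) ys))
  (cong₂ _+_ (length-map (x ·_) ys) (length-cartesianProductWith _·_ xs ys))

choices : (Fin k → List A) → List (Fin k → A)
choices {k = zero}  L = [ (λ ()) ]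
choices {k = suc k} L = cartesianProductWith Vector._∷_ (L zero) (choices (L ∘ suc))

∈-choices⁻ : (L : Fin k → List A) {σ : Fin k → A} → σ ∈ choices L → ∀ i → σ i ∈ L i
∈-choices⁻ {k = suc k} L σ∈ i with ∈-cartesianProductWith⁻ Vector._∷_ (L zero) (choices (L ∘ suc)) σ∈
∈-choices⁻ {k = suc k} L σ∈ zero    | x , τ , x∈ , τ∈ , refl = x∈
∈-choices⁻ {k = suc k} L σ∈ (suc i) | x , τ , x∈ , τ∈ , refl = ∈-choices⁻ (L ∘ suc) τ∈ i

∈-choices⁺ : (L : Fin k → List A) (f : Fin k → A) → (∀ i → f i ∈ L i) → ∃ λ σ → σ ∈ choices L × (∀ i → σ i ≡ f i)
∈-choices⁺ {k = zero}  L f f∈ = (λ ()) , here refl , λ ()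
∈-choices⁺ {k = suc k} L f f∈ =
  let (τ , τ∈ , τ≗) = ∈-choices⁺ (L ∘ suc) (f ∘ suc) (f∈ ∘ suc)
  in  (f zero Vector.∷ τ) , ∈-cartesianProductWith⁺ Vector._∷_ (f∈ zero) τ∈ , λ { zero → refl ; (suc i) → τ≗ i }

sum-map-∏-choices : (L : Fin k → List A) (g : Fin k → A → ℕ) →
  sum (map (λ σ → ∏ (λ i → g i (σ i))) (choices L)) ≡ ∏ (λ i → sum (map (g i) (L i)))
sum-map-∏-choices {k = zero}  L g = refl
sum-map-∏-choices {k = suc k} L g =
  trans (sum-map-cartesianProductWith Vector._∷_ _ (g zero) (λ τ → ∏ (λ i → g (suc i) (τ i))) (λ _ _ → refl)
           (L zero) (choices (L ∘ suc)))
        (cong (sum (map (g zero) (L zero)) *_) (sum-map-∏-choices (L ∘ suc) (g ∘ suc)))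

length-choices : (L : Fin k → List A) → length (choices L) ≡ ∏ (length ∘ L)
length-choices {k = zero}  L = refl
length-choices {k = suc k} L = trans (length-cartesianProductWith Vector._∷_ (L zero) (choices (L ∘ suc)))
  (cong (length (L zero) *_) (length-choices (L ∘ suc)))

isMinimum-⇔ : (P : A → Set) (Q : B → Set) (f : A → ℕ) (g : B → ℕ) →
  (∀ {x} → P x → ∃ λ y → Q y × g y ≤ f x) → (∀ {y} → Q y → ∃ λ x → P x × f x ≤ g y) →
  ∀ k → IsMinimum (λ j → ∃ λ x → P x × f x ≡ j) k ⇔ IsMinimum (λ j → ∃ λ y → Q y × g y ≡ j) k
isMinimum-⇔ P Q f g P⇒Q Q⇒P k = mk⇔ (transfer P Q f g P⇒Q Q⇒P) (transfer Q P g f Q⇒P P⇒Q)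
  where
  transfer : (P : A → Set) (Q : B → Set) (f : A → ℕ) (g : B → ℕ) →
    (∀ {x} → P x → ∃ λ y → Q y × g y ≤ f x) → (∀ {y} → Q y → ∃ λ x → P x × f x ≤ g y) →
    IsMinimum (λ j → ∃ λ x → P x × f x ≡ j) k → IsMinimum (λ j → ∃ λ y → Q y × g y ≡ j) k
  transfer P Q f g P⇒Q Q⇒P ((x , Px , refl) , minimal) with P⇒Q Px
  ... | y , Qy , gy≤fx = (y , Qy , ≤-antisym gy≤fx (fx≤ (y , Qy , refl))) , λ _ → fx≤
    where
    fx≤ : ∀ {j} → (∃ λ y → Q y × g y ≡ j) → f x ≤ j
    fx≤ (y′ , Qy′ , refl) with Q⇒P Qy′
    ... | x′ , Px′ , fx′≤gy′ = ≤-trans (minimal _ (x′ , Px′ , refl)) fx′≤gy′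

_≟ₛ_ : ∀ {n} (p q : Subset n) → Dec (p ≡ q)
_≟ₛ_ = ≡-dec Bool._≟_

module _ {n : ℕ} {P : Fin n → Set} (P? : Decidable P) where

  ∈-tabulate⁺ : ∀ {x} → P x → x ∈ₛ Vec.tabulate (does ∘ P?)
  ∈-tabulate⁺ {x} Px = lookup⇒[]= x _ (trans (lookup∘tabulate (does ∘ P?) x) (dec-true (P? x) Px))

  ∈-tabulate⁻ : ∀ {x} → x ∈ₛ Vec.tabulate (does ∘ P?) → P x
  ∈-tabulate⁻ {x} x∈ with P? x | trans (sym (lookup∘tabulate (does ∘ P?) x)) ([]=⇒lookup x∈)
  ... | yes Px | _  = Px
  ... | no  _  | ()

x∈p─q⇒x∉q : ∀ {n} {x : Fin n} (p q : Subset n) → x ∈ₛ p ─ q → x ∉ₛ q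
x∈p─q⇒x∉q (_ ∷ p) (outside ∷ q) hereᵥ        ()
x∈p─q⇒x∉q (_ ∷ p) (inside ∷ q)  ()           hereᵥ
x∈p─q⇒x∉q (_ ∷ p) (_ ∷ q)       (thereᵥ x∈) (thereᵥ x∈q) = x∈p─q⇒x∉q p q x∈ x∈q

module _ {n : ℕ} {e : Subset n} {a b : Fin n} where

  ∈-swap⁻ : ∀ {x} → x ∈ₛ swap e a b → (x ∈ₛ e × x ≢ a) ⊎ x ≡ b
  ∈-swap⁻ x∈ with x∈p∪q⁻ (e ─ ⁅ a ⁆) ⁅ b ⁆ x∈
  ... | inj₁ x∈e-a = inj₁ (p─q⊆p e ⁅ a ⁆ x∈e-a , x∉⁅y⁆⇒x≢y (x∈p─q⇒x∉q e ⁅ a ⁆ x∈e-a))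
  ... | inj₂ x∈⁅b⁆ = inj₂ (x∈⁅y⁆⇒x≡y b x∈⁅b⁆)

  ∈-swap⁺ˡ : ∀ {x} → x ∈ₛ e → x ≢ a → x ∈ₛ swap e a b
  ∈-swap⁺ˡ x∈e x≢a = x∈p∪q⁺ (inj₁ (x∈p∧x≢y⇒x∈p-y x∈e x≢a))

  ∈-swap⁺ʳ : b ∈ₛ swap e a b
  ∈-swap⁺ʳ = x∈p∪q⁺ (inj₂ (x∈⁅x⁆ b))

  a∉swap : a ≢ b → a ∉ₛ swap e a b
  a∉swap a≢b a∈ with ∈-swap⁻ a∈
  ... | inj₁ (_ , a≢a) = a≢a refl
  ... | inj₂ a≡b       = a≢b a≡b

  swap-⊆ : b ∈ₛ e → swap e a b ⊆ e
  swap-⊆ b∈e x∈ with ∈-swap⁻ x∈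
  ... | inj₁ (x∈e , _) = x∈e
  ... | inj₂ refl      = b∈e

module _ {n : ℕ} where

  image : (Fin n → Fin n) → Subset n → Subset n
  image f s = Vec.tabulate (λ u → does (any? (λ v → (v ∈? s) ×-dec (f v ≟ u))))

  ∈-image⁺ : ∀ f {s v} → v ∈ₛ s → f v ∈ₛ image f s
  ∈-image⁺ f {s} {v} v∈ = ∈-tabulate⁺ (λ u → any? (λ v → (v ∈? s) ×-dec (f v ≟ u))) (v , v∈ , refl)

  ∈-image⁻ : ∀ f {s u} → u ∈ₛ image f s → ∃ λ v → v ∈ₛ s × f v ≡ u
  ∈-image⁻ f {s} = ∈-tabulate⁻ (λ u → any? (λ v → (v ∈? s) ×-dec (f v ≟ u)))

  image-cong : ∀ {f g s} → (∀ {v} → v ∈ₛ s → f v ≡ g v) → image f s ≡ image g s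
  image-cong {f} {g} {s} f≡g = ⊆-antisym (transport f g f≡g) (transport g f (sym ∘ f≡g))
    where
    transport : ∀ f g → (∀ {v} → v ∈ₛ s → f v ≡ g v) → image f s ⊆ image g s
    transport f g f≡g u∈ with ∈-image⁻ f u∈
    ... | v , v∈ , refl = subst (_∈ₛ image g s) (sym (f≡g v∈)) (∈-image⁺ g v∈)

  image-identity : ∀ {f s} → (∀ {v} → v ∈ₛ s → f v ≡ v) → image f s ≡ s
  image-identity {f} {s} f≡id = ⊆-antisym image⊆s (λ {v} v∈ → subst (_∈ₛ image f s) (f≡id v∈) (∈-image⁺ f v∈))
    where
    image⊆s : image f s ⊆ s
    image⊆s u∈ with ∈-image⁻ f u∈
    ... | v , v∈ , refl = subst (_∈ₛ s) (sym (f≡id v∈)) v∈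

  ⊆∧⊄⇒⊇ : ∀ {p q : Subset n} → p ⊆ q → ¬ p ⊂ q → q ⊆ p
  ⊆∧⊄⇒⊇ {p} p⊆q p⊄q {x} x∈q with x ∈? p
  ... | yes x∈p = x∈p
  ... | no  x∉p = contradiction ((λ {y} → p⊆q {y}) , x , x∈q , x∉p) p⊄q

  minimalEdge-⊆ : (H : Hypergraph n) {e : Subset n} → IsEdge H e → ∃ λ f → MinimalEdge H f × f ⊆ e
  minimalEdge-⊆ H {e} = below e (⊂-wellFounded e)
    where
    below : ∀ e → Acc _⊂_ e → IsEdge H e → ∃ λ f → MinimalEdge H f × f ⊆ e
    below e (acc smaller) e∈H with Any.any? (_⊂? e) H
    ... | yes some⊂e =
      let (f , f∈H , f⊂e) = find some⊂e
          (g , g-min , g⊆f) = below f (smaller f⊂e) f∈H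
      in  g , g-min , proj₁ f⊂e ∘ g⊆f
    ... | no none⊂e = e , (e∈H , λ f f∈H f⊆e → ⊆-antisym f⊆e (⊆∧⊄⇒⊇ f⊆e (none⊂e ∘ lose f∈H))) , id

  deduplicate-isRCoverOf : (R : Hypergraph n) (P : Subset n → Set) (C : List (Subset n)) →
    (∀ {c} → c ∈ C → IsEdge R c) → CoversPred P C → IsRCoverOf R P (deduplicate _≟ₛ_ C)
  deduplicate-isRCoverOf R P C C⊆R covers =
    (UniqueDec.deduplicate-! _≟ₛ_ C , All.tabulate (C⊆R ∘ ∈-deduplicate⁻ _≟ₛ_ C)) ,
    λ e Pe → let (c , c∈ , c⊆e) = covers e Pe in c , ∈-deduplicate⁺ _≟ₛ_ c∈ , c⊆e

module Classes {n m} (cls : Fin n → Fin m) where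

  PartialTransversal : Subset n → Set
  PartialTransversal s = ∀ a b → a ∈ₛ s → b ∈ₛ s → cls a ≡ cls b → a ≡ b

  partialTransversal? : Decidable PartialTransversal
  partialTransversal? s = all? λ a → all? λ b → (a ∈? s) →-dec ((b ∈? s) →-dec ((cls a ≟ cls b) →-dec (a ≟ b)))

  ClassPreserving : (Fin n → Fin n) → Set
  ClassPreserving f = ∀ v → cls (f v) ≡ cls v

  SwapClosed : (Subset n → Set) → Set
  SwapClosed P = ∀ e a b → cls a ≡ cls b → a ≢ b → a ∈ₛ e → b ∉ₛ e → P e → P (swap e a b)

  image-updateAt : ∀ {s g a b} → PartialTransversal s → ClassPreserving g → a ∈ₛ s → g a ≡ a →
    cls b ≡ cls a → b ≢ a →
    image (updateAt g a (λ _ → b)) s ≡ swap (image g s) a b × a ∈ₛ image g s × b ∉ₛ image g s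
  image-updateAt {s} {g} {a} {b} pt g-cls a∈s ga≡a b~a b≢a = ⊆-antisym ⊆swap swap⊆ , a∈image , b∉image
    where
    g′ = updateAt g a (λ _ → b)
    only-a : ∀ {v} → v ∈ₛ s → cls v ≡ cls a → v ≡ a
    only-a v∈s v~a = pt _ a v∈s a∈s v~a
    ⊆swap : image g′ s ⊆ swap (image g s) a b
    ⊆swap u∈ with ∈-image⁻ g′ u∈
    ... | v , v∈s , refl with v ≟ a
    ...   | yes refl = subst (_∈ₛ swap (image g s) a b) (sym (updateAt-updates a g)) ∈-swap⁺ʳ
    ...   | no  v≢a  = subst (_∈ₛ swap (image g s) a b) (sym (updateAt-minimal v a g v≢a))
                         (∈-swap⁺ˡ (∈-image⁺ g v∈s) (λ gv≡a → v≢a (only-a v∈s (trans (sym (g-cls v)) (cong cls gv≡a)))))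
    swap⊆ : swap (image g s) a b ⊆ image g′ s
    swap⊆ x∈ with ∈-swap⁻ x∈
    ... | inj₂ refl = subst (_∈ₛ image g′ s) (updateAt-updates a g) (∈-image⁺ g′ a∈s)
    ... | inj₁ (x∈image , x≢a) with ∈-image⁻ g x∈image
    ...   | v , v∈s , refl with v ≟ a
    ...     | yes refl = contradiction ga≡a x≢a
    ...     | no  v≢a  = subst (_∈ₛ image g′ s) (updateAt-minimal v a g v≢a) (∈-image⁺ g′ v∈s)
    a∈image : a ∈ₛ image g s
    a∈image = subst (_∈ₛ image g s) ga≡a (∈-image⁺ g a∈s)
    b∉image : b ∉ₛ image g s
    b∉image b∈ with ∈-image⁻ g b∈
    ... | v , v∈s , refl = b≢a (trans (cong g (only-a v∈s (trans (sym (g-cls v)) b~a))) ga≡a)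

  moveOnly : List (Fin n) → (Fin n → Fin n) → Fin n → Fin n
  moveOnly []       f = id
  moveOnly (a ∷ as) f = updateAt (moveOnly as f) a (λ _ → f a)

  moveOnly-∈ : ∀ {f v} as → v ∈ as → moveOnly as f v ≡ f v
  moveOnly-∈ {f} (a ∷ as) (here refl) = updateAt-updates a (moveOnly as f)
  moveOnly-∈ {f} {v} (a ∷ as) (there v∈as) with v ≟ a
  ... | yes refl = updateAt-updates a (moveOnly as f)
  ... | no  v≢a  = trans (updateAt-minimal v a (moveOnly as f) v≢a) (moveOnly-∈ as v∈as)

  moveOnly-∉ : ∀ {f a} as → All (a ≢_) as → moveOnly as f a ≡ a
  moveOnly-∉         []       _            = refl
  moveOnly-∉ {f} {a} (b ∷ bs) (a≢b All.∷ a∉bs) =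
    trans (updateAt-minimal a b (moveOnly bs f) a≢b) (moveOnly-∉ bs a∉bs)

  moveOnly-cls : ∀ {f} → ClassPreserving f → ∀ as → ClassPreserving (moveOnly as f)
  moveOnly-cls f-cls []       v = refl
  moveOnly-cls {f} f-cls (a ∷ as) v with v ≟ a
  ... | yes refl = trans (cong cls (updateAt-updates a (moveOnly as f))) (f-cls a)
  ... | no  v≢a  = trans (cong cls (updateAt-minimal v a (moveOnly as f) v≢a)) (moveOnly-cls f-cls as v)

  -- A class-preserving map is applied one vertex at a time; each step that changes the image is a swap.
  image-preserves : ∀ {P} → SwapClosed P → ∀ {s f} → PartialTransversal s → ClassPreserving f → P s → P (image f s)
  image-preserves {P} closed {s} {f} pt f-cls Ps =
    subst P (image-cong (λ {v} _ → moveOnly-∈ (allFin n) (∈-allFin v))) (moved (allFin n) (allFin⁺ n))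
    where
    extend : ∀ {g} a → ClassPreserving g → g a ≡ a → P (image g s) → P (image (updateAt g a (λ _ → f a)) s)
    extend {g} a g-cls ga≡a Pg with a ∈? s | f a ≟ a
    ... | no a∉s | _ = subst P (image-cong λ v∈s → sym (updateAt-minimal _ a g λ { refl → a∉s v∈s })) Pg
    ... | yes _ | yes fa≡a = subst P (sym (image-cong λ {v} _ → updateAt-id-local a g (trans fa≡a (sym ga≡a)) v)) Pg
    ... | yes a∈s | no fa≢a =
      let (image≡swap , a∈ , fa∉) = image-updateAt pt g-cls a∈s ga≡a (f-cls a) fa≢a
      in  subst P (sym image≡swap) (closed (image g s) a (f a) (sym (f-cls a)) (fa≢a ∘ sym) a∈ fa∉ Pg)
    moved : ∀ as → Unique as → P (image (moveOnly as f) s)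
    moved []       _                 = subst P (sym (image-identity (λ _ → refl))) Ps
    moved (a ∷ as) (a∉as ∷ unique-as) =
      extend a (moveOnly-cls f-cls as) (moveOnly-∉ as a∉as) (moved as unique-as)

  minimalEdge⇒partialTransversal : (H : Hypergraph n) → (∀ a b → cls a ≡ cls b → MinEqual H a b) →
    ∀ {e} → MinimalEdge H e → PartialTransversal e
  minimalEdge⇒partialTransversal H minEq {e} e-min a b a∈e b∈e a~b with a ≟ b
  ... | yes a≡b = a≡b
  ... | no  a≢b with minEq a b a~b
  ...   | inj₁ a≡b   = a≡b
  ...   | inj₂ swaps =
    let swap∈H = proj₁ (proj₁ (swaps e e-min) a∈e)
    in  contradiction (subst (a ∈ₛ_) (sym (proj₂ e-min _ swap∈H (swap-⊆ b∈e))) a∈e) (a∉swap a≢b)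

  minEqual-swapClosed : (H : Hypergraph n) → (∀ a b → cls a ≡ cls b → MinEqual H a b) → SwapClosed (MinimalEdge H)
  minEqual-swapClosed H minEq e a b a~b a≢b a∈e _ e-min with minEq a b a~b
  ... | inj₁ a≡b   = contradiction a≡b a≢b
  ... | inj₂ swaps = proj₁ (swaps e e-min) a∈e

  rEqual-swapClosed : (R : Hypergraph n) → (∀ a b → cls a ≡ cls b → REqual R a b) → SwapClosed (IsEdge R)
  rEqual-swapClosed R rEq e a b a~b _ a∈e b∉e e∈R = proj₁ (rEq a b a~b e e∈R) a∈e b∉e

module Reduction {n m} (R H : Hypergraph n) (cls : Fin n → Fin m) (rep : Fin m → Fin n)
  (cls-rep : ∀ α → cls (rep α) ≡ α) (equal : ∀ a b → cls a ≡ cls b → MinEqual H a b × REqual R a b) where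

  open Classes cls

  w : Fin n → ℕ
  w = weight cls rep

  ρ : Fin n → Fin n
  ρ v = rep (cls v)

  ρ-cls : ClassPreserving ρ
  ρ-cls v = cls-rep (cls v)

  ρ-∘ : ∀ {f} → ClassPreserving f → ∀ v → ρ (f v) ≡ ρ v
  ρ-∘ f-cls v = cong rep (f-cls v)

  ρ-rep : ∀ {x} → (∃ λ α → rep α ≡ x) → ρ x ≡ x
  ρ-rep (α , refl) = cong rep (cls-rep α)

  reps : Subset n
  reps = Vec.tabulate (λ v → does (ρ v ≟ v))

  ∈-reps⁺ : ∀ {v} → ρ v ≡ v → v ∈ₛ reps
  ∈-reps⁺ = ∈-tabulate⁺ (λ v → ρ v ≟ v)

  ∈-reps⁻ : ∀ {v} → v ∈ₛ reps → ρ v ≡ v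
  ∈-reps⁻ = ∈-tabulate⁻ (λ v → ρ v ≟ v)

  image-ρ⊆reps : ∀ s → image ρ s ⊆ reps
  image-ρ⊆reps s u∈ with ∈-image⁻ ρ u∈
  ... | v , _ , refl = ∈-reps⁺ (ρ-∘ ρ-cls v)

  reps-partialTransversal : ∀ {K} → K ⊆ reps → PartialTransversal K
  reps-partialTransversal K⊆reps a b a∈K b∈K a~b =
    trans (sym (∈-reps⁻ (K⊆reps a∈K))) (trans (cong rep a~b) (∈-reps⁻ (K⊆reps b∈K)))

  image-minimalEdge : ∀ {e f} → ClassPreserving f → MinimalEdge H e → MinimalEdge H (image f e)
  image-minimalEdge f-cls e-min =
    image-preserves (minEqual-swapClosed H minEqual) (minimalEdge⇒partialTransversal H minEqual e-min) f-cls e-min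
    where
    minEqual : ∀ a b → cls a ≡ cls b → MinEqual H a b
    minEqual a b = proj₁ ∘ equal a b

  image-edgeR : ∀ {e f} → PartialTransversal e → ClassPreserving f → IsEdge R e → IsEdge R (image f e)
  image-edgeR = image-preserves (rEqual-swapClosed R (λ a b → proj₂ ∘ equal a b))

  classmates : Fin m → List (Fin n)
  classmates α = filter (λ v → cls v ≟ α) (allFin n)

  ∈-classmates⁺ : ∀ {v α} → cls v ≡ α → v ∈ classmates α
  ∈-classmates⁺ {v} = ∈-filter⁺ (λ v → cls v ≟ _) (∈-allFin v)

  ∈-classmates⁻ : ∀ {v α} → v ∈ classmates α → cls v ≡ α
  ∈-classmates⁻ = proj₂ ∘ ∈-filter⁻ (λ v → cls v ≟ _) {xs = allFin n}

  weight-rep : ∀ {u} → u ∈ₛ reps → w u ≡ length (classmates (cls u))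
  weight-rep {u} u∈reps with u ≟ rep (cls u)
  ... | yes _    = sym (length-filter-tabulate (λ v → cls v ≟ cls u) id)
  ... | no  u≢ρu = contradiction (sym (∈-reps⁻ u∈reps)) u≢ρu

  targets : Subset n → Fin n → List (Fin n)
  targets K u = if does (u ∈? K) then classmates (cls u) else [ u ]

  relabellings : Subset n → List (Fin n → Fin n)
  relabellings K = choices (targets K)

  ∈-targets-self : ∀ {K} u → u ∈ targets K u
  ∈-targets-self {K} u with u ∈? K
  ... | yes _ = ∈-classmates⁺ refl
  ... | no  _ = here refl

  ∈-targets-cls : ∀ {K u x} → x ∈ targets K u → cls x ≡ cls u
  ∈-targets-cls {K} {u} x∈ with u ∈? K | x∈
  ... | yes _ | x∈classmates = ∈-classmates⁻ x∈classmates
  ... | no  _ | here x≡u     = cong cls x≡u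

  targets-unique : ∀ {K} u → Unique (targets K u)
  targets-unique {K} u with u ∈? K
  ... | yes _ = filter⁺ (λ v → cls v ≟ cls u) (allFin⁺ n)
  ... | no  _ = All.[] ∷ []

  length-targets-reps : ∀ {u} → u ∈ₛ reps → length (targets reps u) ≡ w u
  length-targets-reps {u} u∈reps with u ∈? reps
  ... | yes _      = sym (weight-rep u∈reps)
  ... | no  u∉reps = contradiction u∈reps u∉reps

  relabelling-cls : ∀ {K σ} → σ ∈ relabellings K → ClassPreserving σ
  relabelling-cls {K} σ∈ u = ∈-targets-cls (∈-choices⁻ (targets K) σ∈ u)

  length-relabellings : ∀ {K} → K ⊆ reps → length (relabellings K) ≡ edgeWeight w K
  length-relabellings {K} K⊆reps = begin
    length (choices (targets K))                 ≡⟨ length-choices (targets K) ⟩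
    ∏ (length ∘ targets K)                       ≡⟨ ∏-cong target-count ⟩
    ∏ (λ u → if does (u ∈? K) then w u else 1)  ≡⟨ product-map-filter-tabulate (_∈? K) w id ⟨
    edgeWeight w K                               ∎
    where
    open ≡-Reasoning
    target-count : ∀ u → length (targets K u) ≡ (if does (u ∈? K) then w u else 1)
    target-count u with u ∈? K
    ... | yes u∈K = sym (weight-rep (K⊆reps u∈K))
    ... | no  _   = refl

  lifts : Subset n → List (Subset n)
  lifts r = map (λ σ → image σ r) (relabellings r)

  length-lifts : ∀ {r} → r ⊆ reps → length (lifts r) ≡ edgeWeight w r
  length-lifts {r} r⊆reps = trans (length-map _ (relabellings r)) (length-relabellings r⊆reps)

  target-into : ∀ {r f} → r ⊆ image ρ f → ∀ u → ∃ λ x → x ∈ targets r u × (u ∈ₛ r → x ∈ₛ f)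
  target-into {r} r⊆ρf u with u ∈? r
  ... | yes u∈r = let (v , v∈f , ρv≡u) = ∈-image⁻ ρ (r⊆ρf u∈r)
                  in  v , ∈-classmates⁺ (trans (sym (ρ-cls v)) (cong cls ρv≡u)) , λ _ → v∈f
  ... | no  u∉r = u , here refl , λ u∈r → contradiction u∈r u∉r

  relabelling-into : ∀ {r f} → r ⊆ image ρ f → ∃ λ σ → σ ∈ relabellings r × image σ r ⊆ f
  relabelling-into {r} {f} r⊆ρf
    with ∈-choices⁺ (targets r) (proj₁ ∘ target-into r⊆ρf) (proj₁ ∘ proj₂ ∘ target-into r⊆ρf)
  ... | σ , σ∈ , σ≗ = σ , σ∈ , image⊆f
    where
    image⊆f : image σ r ⊆ f
    image⊆f x∈ with ∈-image⁻ σ x∈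
    ... | u , u∈r , refl = subst (_∈ₛ f) (sym (σ≗ u)) (proj₂ (proj₂ (target-into r⊆ρf u)) u∈r)

  cover-from-weightedCover : ∀ {R′} → IsRCoverOf R (HcovEdge H rep) R′ →
    ∃ λ C → IsRCoverOf R (IsEdge H) C × length C ≤ coverWeight w R′
  cover-from-weightedCover {R′} ((_ , R′⊆R) , covers) =
    deduplicate _≟ₛ_ lifted , deduplicate-isRCoverOf R (IsEdge H) lifted lifted⊆R lifted-covers , size
    where
    onReps : List (Subset n)
    onReps = filter (_⊆? reps) R′
    lifted : List (Subset n)
    lifted = concatMap lifts onReps
    size : length (deduplicate _≟ₛ_ lifted) ≤ coverWeight w R′
    size = begin
      length (deduplicate _≟ₛ_ lifted)  ≤⟨ length-deduplicate _≟ₛ_ lifted ⟩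
      length lifted                     ≡⟨ length-concatMap lifts onReps ⟩
      sum (map (length ∘ lifts) onReps) ≡⟨ cong sum (map-cong-local (All.tabulate {xs = onReps} length-onReps)) ⟩
      sum (map (edgeWeight w) onReps)   ≤⟨ sum-map-filter-≤ (_⊆? reps) (edgeWeight w) R′ ⟩
      coverWeight w R′                  ∎
      where
      open ≤-Reasoning
      length-onReps : ∀ {r} → r ∈ onReps → length (lifts r) ≡ edgeWeight w r
      length-onReps = length-lifts ∘ proj₂ ∘ ∈-filter⁻ (_⊆? reps) {xs = R′}
    lifted⊆R : ∀ {c} → c ∈ lifted → IsEdge R c
    lifted⊆R c∈ with find (∈-concatMap⁻ lifts {xs = onReps} c∈)
    ... | r , r∈onReps , c∈lifts with ∈-filter⁻ (_⊆? reps) {xs = R′} r∈onReps | ∈-map⁻ (λ σ → image σ r) c∈lifts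
    ...   | r∈R′ , r⊆reps | σ , σ∈ , refl =
      image-edgeR (reps-partialTransversal r⊆reps) (relabelling-cls σ∈) (All.lookup R′⊆R r∈R′)
    lifted-covers : CoversPred (IsEdge H) lifted
    lifted-covers e e∈H with minimalEdge-⊆ H e∈H
    ... | f , f-min , f⊆e with covers (image ρ f) (image-minimalEdge ρ-cls f-min , ρf-reps)
      where
      ρf-reps : ∀ u → u ∈ₛ image ρ f → ∃ λ α → rep α ≡ u
      ρf-reps u u∈ with ∈-image⁻ ρ u∈
      ... | v , _ , ρv≡u = cls v , ρv≡u
    ...   | r , r∈R′ , r⊆ρf with relabelling-into r⊆ρf
    ...     | σ , σ∈ , σr⊆f =
      image σ r ,
      ∈-concatMap⁺ lifts (lose (∈-filter⁺ (_⊆? reps) r∈R′ (image-ρ⊆reps f ∘ r⊆ρf)) (∈-map⁺ (λ σ → image σ r) σ∈)) ,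
      ⊆-trans σr⊆f f⊆e

  -- For a relabelling σ of reps this is {σ(v_α)}: one vertex of every class.
  transversal : (Fin n → Fin n) → Subset n
  transversal σ = Vec.tabulate (λ v → does (σ (ρ v) ≟ v))

  ∈-transversal⁺ : ∀ σ {v} → σ (ρ v) ≡ v → v ∈ₛ transversal σ
  ∈-transversal⁺ σ = ∈-tabulate⁺ (λ v → σ (ρ v) ≟ v)

  ∈-transversal⁻ : ∀ σ {v} → v ∈ₛ transversal σ → σ (ρ v) ≡ v
  ∈-transversal⁻ σ = ∈-tabulate⁻ (λ v → σ (ρ v) ≟ v)

  transversal-partialTransversal : ∀ σ {c} → c ⊆ transversal σ → PartialTransversal c
  transversal-partialTransversal σ c⊆T a b a∈c b∈c a~b =
    trans (sym (∈-transversal⁻ σ (c⊆T a∈c))) (trans (cong (σ ∘ rep) a~b) (∈-transversal⁻ σ (c⊆T b∈c)))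

  selected : List (Subset n) → (Fin n → Fin n) → List (Subset n)
  selected C σ = map (image ρ) (filter (_⊆? transversal σ) C)

  selectedWeight : (Fin n → Fin n) → Subset n → ℕ
  selectedWeight σ c = if does (c ⊆? transversal σ) then edgeWeight w (image ρ c) else 0

  coverWeight-selected : ∀ C σ → coverWeight w (selected C σ) ≡ sum (map (selectedWeight σ) C)
  coverWeight-selected C σ = trans (cong sum (sym (map-∘ (filter (_⊆? transversal σ) C))))
                                   (sum-map-filter (_⊆? transversal σ) (edgeWeight w ∘ image ρ) C)

  -- A product bound on selectedWeight σ c whose sum over all σ factorises over the vertices.
  selectionBound : Subset n → Fin n → Fin n → ℕ
  selectionBound c u x =
    if does (u ∈? image ρ c) then (if does (x ∈? c) then length (targets reps u) else 0) else 1

  selectedWeight≤∏ : ∀ σ c → selectedWeight σ c ≤ ∏ (λ u → selectionBound c u (σ u))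
  selectedWeight≤∏ σ c with c ⊆? transversal σ
  ... | no  _   = z≤n
  ... | yes c⊆T = begin
    edgeWeight w (image ρ c)                             ≡⟨ product-map-filter-tabulate (_∈? image ρ c) w id ⟩
    ∏ (λ u → if does (u ∈? image ρ c) then w u else 1)  ≤⟨ ∏-mono-≤ _ _ factor≤ ⟩
    ∏ (λ u → selectionBound c u (σ u))                   ∎
    where
    open ≤-Reasoning
    factor≤ : ∀ u → (if does (u ∈? image ρ c) then w u else 1) ≤ selectionBound c u (σ u)
    factor≤ u with u ∈? image ρ c
    ... | no  _   = ≤-refl
    ... | yes u∈ρc with σ u ∈? c
    ...   | yes _    = ≤-reflexive (sym (length-targets-reps (image-ρ⊆reps c u∈ρc)))
    ...   | no  σu∉c with ∈-image⁻ ρ u∈ρc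
    ...     | v , v∈c , refl = contradiction (subst (_∈ₛ c) (sym (∈-transversal⁻ σ (c⊆T v∈c))) v∈c) σu∉c

  sum-selectionBound : ∀ {c} → PartialTransversal c → ∀ u →
    sum (map (selectionBound c u) (targets reps u)) ≤ length (targets reps u)
  sum-selectionBound {c} pt u with u ∈? image ρ c
  ... | no  _ = ≤-reflexive (trans (sum-map-const 1 (targets reps u)) (*-identityʳ _))
  ... | yes _ = begin
    sum (map (λ x → if does (x ∈? c) then length ts else 0) ts)  ≡⟨ sum-map-filter (_∈? c) (λ _ → length ts) ts ⟨
    sum (map (λ _ → length ts) (filter (_∈? c) ts))              ≡⟨ sum-map-const (length ts) (filter (_∈? c) ts) ⟩
    length (filter (_∈? c) ts) * length ts                       ≤⟨ *-monoˡ-≤ (length ts) at-most-one ⟩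
    1 * length ts                                                ≡⟨ *-identityˡ (length ts) ⟩
    length ts                                                    ∎
    where
    open ≤-Reasoning
    ts : List (Fin n)
    ts = targets reps u
    at-most-one : length (filter (_∈? c) ts) ≤ 1
    at-most-one = unique⇒length≤1 (filter⁺ (_∈? c) (targets-unique u)) λ x∈ y∈ →
      let (x∈ts , x∈c) = ∈-filter⁻ (_∈? c) {xs = ts} x∈
          (y∈ts , y∈c) = ∈-filter⁻ (_∈? c) {xs = ts} y∈
      in  pt _ _ x∈c y∈c (trans (∈-targets-cls x∈ts) (sym (∈-targets-cls y∈ts)))

  sum-selectedWeight : ∀ c → sum (map (λ σ → selectedWeight σ c) (relabellings reps)) ≤ length (relabellings reps)
  sum-selectedWeight c with partialTransversal? c
  ... | no ¬pt = begin
    sum (map (λ σ → selectedWeight σ c) S)  ≤⟨ sum-map-mono-≤ _ (λ _ → 1) S (λ {σ} _ → unselected σ) ⟩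
    sum (map (λ _ → 1) S)                   ≡⟨ sum-map-const 1 S ⟩
    length S * 1                            ≡⟨ *-identityʳ _ ⟩
    length S                                ∎
    where
    open ≤-Reasoning
    S : List (Fin n → Fin n)
    S = relabellings reps
    unselected : ∀ σ → selectedWeight σ c ≤ 1
    unselected σ with c ⊆? transversal σ
    ... | yes c⊆T = contradiction (transversal-partialTransversal σ c⊆T) ¬pt
    ... | no  _   = z≤n
  ... | yes pt = begin
    sum (map (λ σ → selectedWeight σ c) S)
      ≤⟨ sum-map-mono-≤ _ _ S (λ {σ} _ → selectedWeight≤∏ σ c) ⟩
    sum (map (λ σ → ∏ (λ u → selectionBound c u (σ u))) S)
      ≡⟨ sum-map-∏-choices (targets reps) (selectionBound c) ⟩
    ∏ (λ u → sum (map (selectionBound c u) (targets reps u)))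
      ≤⟨ ∏-mono-≤ _ _ (sum-selectionBound pt) ⟩
    ∏ (length ∘ targets reps)
      ≡⟨ length-choices (targets reps) ⟨
    length S ∎
    where
    open ≤-Reasoning
    S : List (Fin n → Fin n)
    S = relabellings reps

  sum-coverWeight-selected : ∀ C →
    sum (map (λ σ → coverWeight w (selected C σ)) (relabellings reps)) ≤ length (relabellings reps) * length C
  sum-coverWeight-selected C = begin
    sum (map (λ σ → coverWeight w (selected C σ)) S)
      ≡⟨ cong sum (map-cong (coverWeight-selected C) S) ⟩
    sum (map (λ σ → sum (map (selectedWeight σ) C)) S)
      ≡⟨ sum-map-comm selectedWeight S C ⟩
    sum (map (λ c → sum (map (λ σ → selectedWeight σ c) S)) C)
      ≤⟨ sum-map-mono-≤ _ _ C (λ {c} _ → sum-selectedWeight c) ⟩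
    sum (map (λ _ → length S) C)
      ≡⟨ sum-map-const (length S) C ⟩
    length C * length S
      ≡⟨ *-comm (length C) (length S) ⟩
    length S * length C ∎
    where
    open ≤-Reasoning
    S : List (Fin n → Fin n)
    S = relabellings reps

  selected⊆R : ∀ {C σ c} → All (IsEdge R) C → c ∈ selected C σ → IsEdge R c
  selected⊆R {C} {σ} C⊆R c∈ with ∈-map⁻ (image ρ) c∈
  ... | c′ , c′∈ , refl with ∈-filter⁻ (_⊆? transversal σ) {xs = C} c′∈
  ...   | c′∈C , c′⊆T = image-edgeR (transversal-partialTransversal σ c′⊆T) ρ-cls (All.lookup C⊆R c′∈C)

  selected-covers : ∀ {C σ} → σ ∈ relabellings reps →
    CoversPred (IsEdge H) C → CoversPred (HcovEdge H rep) (selected C σ)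
  selected-covers {C} {σ} σ∈ covers e (e-min , e-reps) =
    select (covers (image τ e) (proj₁ (image-minimalEdge τ-cls e-min)))
    where
    τ : Fin n → Fin n
    τ = σ ∘ ρ
    τ-cls : ClassPreserving τ
    τ-cls v = trans (relabelling-cls σ∈ (ρ v)) (ρ-cls v)
    select : (∃ λ c → c ∈ C × c ⊆ image τ e) → ∃ λ c → c ∈ selected C σ × c ⊆ e
    select (c , c∈C , c⊆τe) = image ρ c , ∈-map⁺ (image ρ) (∈-filter⁺ (_⊆? transversal σ) c∈C c⊆T) , ρc⊆e
      where
      c⊆T : c ⊆ transversal σ
      c⊆T v∈c with ∈-image⁻ τ (c⊆τe v∈c)
      ... | x , _ , refl = ∈-transversal⁺ σ (cong σ (ρ-∘ τ-cls x))
      ρc⊆e : image ρ c ⊆ e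
      ρc⊆e u∈ with ∈-image⁻ ρ u∈
      ... | v , v∈c , refl with ∈-image⁻ τ (c⊆τe v∈c)
      ...   | x , x∈e , refl = subst (_∈ₛ e) (sym (trans (ρ-∘ τ-cls x) (ρ-rep (e-reps x x∈e)))) x∈e

  weightedCover-from-cover : ∀ {C} → IsRCoverOf R (IsEdge H) C →
    ∃ λ R′ → IsRCoverOf R (HcovEdge H rep) R′ × coverWeight w R′ ≤ length C
  weightedCover-from-cover {C} ((_ , C⊆R) , covers)
    with ∃-below-average (λ σ → coverWeight w (selected C σ)) (length C) (relabellings reps)
           (proj₁ (proj₂ (∈-choices⁺ (targets reps) id ∈-targets-self))) (sum-coverWeight-selected C)
  ... | σ , σ∈ , weight≤ =
    deduplicate _≟ₛ_ (selected C σ) ,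
    deduplicate-isRCoverOf R (HcovEdge H rep) (selected C σ) (selected⊆R {σ = σ} C⊆R) (selected-covers σ∈ covers) ,
    ≤-trans (sum-map-deduplicate-≤ _≟ₛ_ (edgeWeight w) (selected C σ)) weight≤

proposition1 : ∀ {n m : ℕ} (R H : Hypergraph n)
    (cls : Fin n → Fin m) (rep : Fin m → Fin n) →
    (∀ α → cls (rep α) ≡ α) →
    (∀ a b → cls a ≡ cls b → MinEqual H a b × REqual R a b) →
    ∀ k → CovIs R H k ⇔ WeightedMinIs R H cls rep k
proposition1 R H cls rep cls-rep equal =
  isMinimum-⇔ (IsRCoverOf R (IsEdge H)) (IsRCoverOf R (HcovEdge H rep)) length (coverWeight (weight cls rep))
              weightedCover-from-cover cover-from-weightedCover
  where open Reduction R H cls rep cls-rep equal
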